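{- Let $D$ be an arc-colored complete digraph of order $n\geq 4$. If $D$ contains no rainbow triangle, then there is a vertex $v\in V(D)$ with $d^{s}(v)\leq \lfloor\frac{n}{2}\rfloor$.
   Context: Digraphs are finite, without loops or multiple arcs; a complete digraph has an arc in each direction between every pair of distinct vertices. An arc-coloring is a map $C:A(D)\to\mathbb{N}$. A color $c$ is saturated by $v$ if every arc of color $c$ is incident to $v$; $d^{s}(v)$ is the number of colors saturated by $v$. A rainbow triangle is a directed $3$-cycle with pairwise distinct arc colors. -}

module Defs where

open import Data.Nat using (ℕ; zero; suc; _+_; _⊔_; _≤_; _<_; _/_)
open import Data.Nat.Properties using (_≟_)
open import Data.Fin using (Fin)
import Data.Fin.Properties as FinP
open import Data.List using (List; []; _∷_; upTo; filter; length; foldr; map; allFin)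
open import Data.List.Relation.Unary.All using (All)
open import Data.List.Relation.Unary.Any using (Any)
open import Data.Product using (_×_; Σ; ∃; _,_)
open import Data.Sum using (_⊎_)
open import Relation.Nullary using (¬_; Dec; yes; no)
open import Relation.Nullary.Decidable using (_×-dec_; _⊎-dec_; ¬?; _→-dec_)
open import Relation.Unary using (Decidable)
open import Relation.Binary.PropositionalEquality using (_≡_; _≢_)
open import Data.List.Relation.Unary.All using (all?)
open import Data.List.Relation.Unary.Any using (any?)

-- An arc-colored complete digraph on vertex set Fin n: every ordered pair
-- (u , w) with u ≢ w is an arc; its color is C u w. Values C u u are
-- irrelevant (no loops) and are never consulted.
ArcColoring : ℕ → Set
ArcColoring n = Fin n → Fin n → ℕ

vertices : (n : ℕ) → List (Fin n)
vertices n = allFin n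

ColorUsed : ∀ {n} → ArcColoring n → ℕ → Set
ColorUsed {n} C c = Any (λ x → Any (λ y → (x ≢ y) × (C x y ≡ c)) (vertices n)) (vertices n)

Saturates : ∀ {n} → ArcColoring n → Fin n → ℕ → Set
Saturates {n} C v c =
  All (λ x → All (λ y → x ≢ y → C x y ≡ c → (x ≡ v ⊎ y ≡ v)) (vertices n)) (vertices n)

maxColor : ∀ {n} → ArcColoring n → ℕ
maxColor {n} C = foldr (λ x m → foldr (λ y k → C x y ⊔ k) m (vertices n)) 0 (vertices n)

colorUsed? : ∀ {n} (C : ArcColoring n) → Decidable (ColorUsed C)
colorUsed? {n} C c =
  any? (λ x → any? (λ y → ¬? (x FinP.≟ y) ×-dec (C x y ≟ c)) (vertices n)) (vertices n)

saturates? : ∀ {n} (C : ArcColoring n) (v : Fin n) → Decidable (Saturates C v)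
saturates? {n} C v c =
  all? (λ x → all? (λ y → ¬? (x FinP.≟ y) →-dec ((C x y ≟ c) →-dec ((x FinP.≟ v) ⊎-dec (y FinP.≟ v)))) (vertices n)) (vertices n)

-- d^s(v): number of (used) colors saturated by v. Every used color is
-- < suc (maxColor C), so counting over upTo (suc (maxColor C)) counts all of them.
satDegree : ∀ {n} → ArcColoring n → Fin n → ℕ
satDegree C v =
  length (filter (λ c → colorUsed? C c ×-dec saturates? C v c) (upTo (suc (maxColor C))))

RainbowTriangle : ∀ {n} → ArcColoring n → Set
RainbowTriangle {n} C =
  Σ (Fin n) λ x → Σ (Fin n) λ y → Σ (Fin n) λ z →
    (x ≢ y) × (y ≢ z) × (x ≢ z) ×
    (C x y ≢ C y z) × (C y z ≢ C z x) × (C x y ≢ C z x)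

-- Call v out-only (in-only) if every colour it saturates lies on an arc leaving
-- (entering) v. A vertex that is neither has d^s(v) ≤ 2 ≤ n/2: if a ≢ b are
-- saturated on arcs v → x and y → v, the cycle v → x → y → v would be rainbow
-- unless x = y, and then every saturated colour is a or b. Reversing all arcs
-- swaps out-only and in-only, so let v be out-only and saturate the colour of
-- v → x. If x is out-only too, the cycles v → x → z → v force every colour
-- saturated by x onto the arc x → v. If x is in-only, every colour saturated by
-- x lies on an arc z → x where z = v or C v z is not saturated by v; counting
-- the heads z of arcs leaving v gives d^s(v) + d^s(x) ≤ n.
module Submission where

open import Defs
open import Data.Nat using (ℕ; suc; _+_; _*_; _≤_; _/_; z≤n; s≤s)
open import Data.Nat.Properties using (_≟_; ≤-trans; ≤-total; +-monoʳ-≤; +-mono-≤; +-suc; +-comm; *-comm; +-identityʳ; module ≤-Reasoning)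
open import Data.Nat.DivMod using (/-monoˡ-≤; m*n/n≡m)
open import Data.Fin using (Fin; fromℕ<)
import Data.Fin.Properties as FinP
open import Data.List using (List; []; _∷_; upTo; filter; length; map; allFin)
open import Data.List.Properties using (length-map; length-tabulate; filter-≐)
import Data.List.Relation.Unary.All as All
open import Data.List.Relation.Unary.Any using (here; there; any?)
open import Data.List.Relation.Unary.AllPairs using (_∷_)
open import Data.List.Relation.Unary.Unique.Propositional using (Unique)
open import Data.List.Relation.Unary.Unique.Propositional.Properties using (upTo⁺; filter⁺)
open import Data.List.Relation.Binary.Subset.Propositional using (_⊆_)
open import Data.List.Membership.Propositional using (_∈_; find; lose)
open import Data.List.Membership.Propositional.Properties using (∈-filter⁺; ∈-filter⁻; ∈-allFin; ∈-map⁺)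
open import Data.Product using (Σ; ∃; ∃₂; _×_; _,_; proj₂)
open import Data.Sum using (_⊎_; inj₁; inj₂; [_,_])
open import Data.Empty using (⊥-elim)
open import Level using (0ℓ)
open import Relation.Nullary using (¬_; yes; no)
open import Relation.Nullary.Decidable using (_×-dec_; ¬?)
open import Relation.Unary using (Pred; Decidable)
open import Relation.Unary.Properties using (∁?)
open import Relation.Binary.PropositionalEquality using (_≡_; _≢_; refl; sym; trans; cong; subst; ≢-sym)

module _ {A : Set} where

  private
    remove : ∀ {x : A} (ys : List A) → x ∈ ys → List A
    remove (_ ∷ ys) (here _)  = ys
    remove (y ∷ ys) (there p) = y ∷ remove ys p

    length-remove : ∀ {x : A} (ys : List A) (p : x ∈ ys) → suc (length (remove ys p)) ≡ length ys
    length-remove (_ ∷ ys) (here _)  = refl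
    length-remove (y ∷ ys) (there p) = cong suc (length-remove ys p)

    ∈-remove : ∀ {x z : A} (ys : List A) (p : x ∈ ys) → z ∈ ys → z ≢ x → z ∈ remove ys p
    ∈-remove (_ ∷ ys) (here refl) (here refl) z≢x = ⊥-elim (z≢x refl)
    ∈-remove (_ ∷ ys) (here refl) (there q)   z≢x = q
    ∈-remove (y ∷ ys) (there p)   (here z≡y)  z≢x = here z≡y
    ∈-remove (y ∷ ys) (there p)   (there q)   z≢x = there (∈-remove ys p q z≢x)

  unique-⊆⇒length-≤ : ∀ {xs ys : List A} → Unique xs → xs ⊆ ys → length xs ≤ length ys
  unique-⊆⇒length-≤ {[]}     _            _   = z≤n
  unique-⊆⇒length-≤ {x ∷ xs} {ys} (x∉xs ∷ u) sub = begin
    suc (length xs)                  ≤⟨ s≤s (unique-⊆⇒length-≤ u sub′) ⟩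
    suc (length (remove ys x∈ys))    ≡⟨ length-remove ys x∈ys ⟩
    length ys                        ∎
    where
    open ≤-Reasoning
    x∈ys : x ∈ ys
    x∈ys = sub (here refl)
    sub′ : xs ⊆ remove ys x∈ys
    sub′ z∈xs = ∈-remove ys x∈ys (sub (there z∈xs)) (λ { refl → All.lookup x∉xs z∈xs refl })

  length-filter-+-length-filter-∁ : ∀ {P : Pred A 0ℓ} (P? : Decidable P) (xs : List A) →
    length (filter P? xs) + length (filter (∁? P?) xs) ≡ length xs
  length-filter-+-length-filter-∁ P? [] = refl
  length-filter-+-length-filter-∁ P? (x ∷ xs) with P? x
  ... | yes _ = cong suc (length-filter-+-length-filter-∁ P? xs)
  ... | no  _ = trans (+-suc _ _) (cong suc (length-filter-+-length-filter-∁ P? xs))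

≤-half-of-sum : ∀ {a b m} → a ≤ b → a + b ≤ m → a ≤ m / 2
≤-half-of-sum {a} {b} {m} a≤b a+b≤m = begin
  a          ≡⟨ sym (m*n/n≡m a 2) ⟩
  a * 2 / 2  ≤⟨ /-monoˡ-≤ 2 (≤-trans a*2≤a+b a+b≤m) ⟩
  m / 2      ∎
  where
  open ≤-Reasoning
  a*2≤a+b : a * 2 ≤ a + b
  a*2≤a+b rewrite *-comm a 2 | +-identityʳ a = +-monoʳ-≤ a a≤b

sum-≤⇒half : ∀ {a b m} → a + b ≤ m → a ≤ m / 2 ⊎ b ≤ m / 2
sum-≤⇒half {a} {b} {m} a+b≤m with ≤-total a b
... | inj₁ a≤b = inj₁ (≤-half-of-sum a≤b a+b≤m)
... | inj₂ b≤a = inj₂ (≤-half-of-sum b≤a (subst (_≤ m) (+-comm a b) a+b≤m))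

SaturatedColor : ∀ {n} → ArcColoring n → Fin n → ℕ → Set
SaturatedColor C v c = ColorUsed C c × Saturates C v c

saturatedColor? : ∀ {n} (C : ArcColoring n) (v : Fin n) → Decidable (SaturatedColor C v)
saturatedColor? C v c = colorUsed? C c ×-dec saturates? C v c

-- satDegree C v is satDegreeBelow (suc (maxColor C)) C v; keeping the bound
-- free lets degrees of C and of its converse (whose maxColor differs) be compared.
saturatedColorsBelow : ∀ {n} → ℕ → ArcColoring n → Fin n → List ℕ
saturatedColorsBelow B C v = filter (saturatedColor? C v) (upTo B)

satDegreeBelow : ∀ {n} → ℕ → ArcColoring n → Fin n → ℕ
satDegreeBelow B C v = length (saturatedColorsBelow B C v)

∈-saturatedColorsBelow⁻ : ∀ {n} B (C : ArcColoring n) v {c} →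
  c ∈ saturatedColorsBelow B C v → SaturatedColor C v c
∈-saturatedColorsBelow⁻ B C v c∈ = proj₂ (∈-filter⁻ (saturatedColor? C v) {xs = upTo B} c∈)

saturatedColorsBelow-unique : ∀ {n} B (C : ArcColoring n) v → Unique (saturatedColorsBelow B C v)
saturatedColorsBelow-unique B C v = filter⁺ (saturatedColor? C v) (upTo⁺ B)

satDegreeBelow-≤ : ∀ {n} B (C : ArcColoring n) v {ys : List ℕ} →
  (∀ {c} → SaturatedColor C v c → c ∈ ys) → satDegreeBelow B C v ≤ length ys
satDegreeBelow-≤ B C v sat⇒∈ =
  unique-⊆⇒length-≤ (saturatedColorsBelow-unique B C v)
    (λ c∈ → sat⇒∈ (∈-saturatedColorsBelow⁻ B C v c∈))

module _ {n : ℕ} (C : ArcColoring n) where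

  colorUsed⁻ : ∀ {c} → ColorUsed C c → ∃₂ λ x y → x ≢ y × C x y ≡ c
  colorUsed⁻ used with find used
  ... | x , _ , arcs with find arcs
  ...   | y , _ , x≢y , e = x , y , x≢y , e

  colorUsed⁺ : ∀ {c} x y → x ≢ y → C x y ≡ c → ColorUsed C c
  colorUsed⁺ x y x≢y e = lose (∈-allFin x) (lose (∈-allFin y) (x≢y , e))

  saturates⁻ : ∀ {w c} → Saturates C w c → ∀ x y → x ≢ y → C x y ≡ c → x ≡ w ⊎ y ≡ w
  saturates⁻ sat x y = All.lookup (All.lookup sat (∈-allFin x)) (∈-allFin y)

  saturates⁺ : ∀ {w c} → (∀ x y → x ≢ y → C x y ≡ c → x ≡ w ⊎ y ≡ w) → Saturates C w c
  saturates⁺ f = All.tabulate (λ {x} _ → All.tabulate (λ {y} _ → f x y))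

  saturates-avoids : ∀ {w c x y} → Saturates C w c → x ≢ w → y ≢ w → x ≢ y → C x y ≢ c
  saturates-avoids sat x≢w y≢w x≢y e = [ x≢w , y≢w ] (saturates⁻ sat _ _ x≢y e)

  OutColor InColor : Fin n → ℕ → Set
  OutColor v c = ∃ λ z → z ≢ v × C v z ≡ c
  InColor  v c = ∃ λ z → z ≢ v × C z v ≡ c

  saturated⇒incident : ∀ {v c} → SaturatedColor C v c → OutColor v c ⊎ InColor v c
  saturated⇒incident (used , sat) with colorUsed⁻ used
  ... | x , y , x≢y , e with saturates⁻ sat x y x≢y e
  ...   | inj₁ refl = inj₁ (y , ≢-sym x≢y , e)
  ...   | inj₂ refl = inj₂ (x , x≢y , e)

  SaturatesOnlyOut SaturatesOnlyIn : Fin n → Set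
  SaturatesOnlyOut v = ∀ {c} → SaturatedColor C v c → ¬ InColor v c
  SaturatesOnlyIn  v = ∀ {c} → SaturatedColor C v c → ¬ OutColor v c

  saturatesOnlyOut⇒out : ∀ {v c} → SaturatesOnlyOut v → SaturatedColor C v c → OutColor v c
  saturatesOnlyOut⇒out onlyOut sc =
    [ (λ o → o) , (λ i → ⊥-elim (onlyOut sc i)) ] (saturated⇒incident sc)

  saturatesOnlyIn⇒in : ∀ {v c} → SaturatesOnlyIn v → SaturatedColor C v c → InColor v c
  saturatesOnlyIn⇒in onlyIn sc =
    [ (λ o → ⊥-elim (onlyIn sc o)) , (λ i → i) ] (saturated⇒incident sc)

  OutSaturating : Fin n → Fin n → Set
  OutSaturating v z = z ≢ v × SaturatedColor C v (C v z)

  outSaturating? : ∀ v → Decidable (OutSaturating v)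
  outSaturating? v z = ¬? (z FinP.≟ v) ×-dec saturatedColor? C v (C v z)

  satDegreeBelow-≤-outSaturating : ∀ B {v} → SaturatesOnlyOut v →
    satDegreeBelow B C v ≤ length (filter (outSaturating? v) (allFin n))
  satDegreeBelow-≤-outSaturating B {v} onlyOut =
    subst (satDegreeBelow B C v ≤_) (length-map (C v) heads) (satDegreeBelow-≤ B C v sat⇒∈)
    where
    heads = filter (outSaturating? v) (allFin n)
    sat⇒∈ : ∀ {c} → SaturatedColor C v c → c ∈ map (C v) heads
    sat⇒∈ sc with saturatesOnlyOut⇒out onlyOut sc
    ... | z , z≢v , refl = ∈-map⁺ (C v) (∈-filter⁺ (outSaturating? v) (∈-allFin z) (z≢v , sc))

module _ {n : ℕ} {C : ArcColoring n} (noRainbow : ¬ RainbowTriangle C) where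

  out-in-same-endpoint : ∀ {v a b x y} →
    SaturatedColor C v a → C v x ≡ a → x ≢ v →
    SaturatedColor C v b → C y v ≡ b → y ≢ v → a ≢ b → x ≡ y
  out-in-same-endpoint {v} {x = x} {y} (_ , sa) ea x≢v (_ , sb) eb y≢v a≢b with x FinP.≟ y
  ... | yes x≡y = x≡y
  ... | no  x≢y = ⊥-elim (noRainbow (v , x , y , ≢-sym x≢v , x≢y , ≢-sym y≢v ,
          (λ e → saturates-avoids C sa x≢v y≢v x≢y (trans (sym e) ea)) ,
          (λ e → saturates-avoids C sb x≢v y≢v x≢y (trans e eb)) ,
          (λ e → a≢b (trans (sym ea) (trans e eb)))))

  saturated-within-pair : ∀ {v a b} →
    SaturatedColor C v a → OutColor C v a → SaturatedColor C v b → InColor C v b → a ≢ b →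
    ∀ {d} → SaturatedColor C v d → d ∈ a ∷ b ∷ []
  saturated-within-pair {v} {a} {b} sa (x , x≢v , ea) sb (y , y≢v , eb) a≢b {d} sd =
    [ fromOut , fromIn ] (saturated⇒incident C sd)
    where
    x≡y : x ≡ y
    x≡y = out-in-same-endpoint sa ea x≢v sb eb y≢v a≢b
    fromOut : OutColor C v d → d ∈ a ∷ b ∷ []
    fromOut (z , z≢v , e) with d ≟ b
    ... | yes d≡b = there (here d≡b)
    ... | no  d≢b = here (trans (sym e) (trans (cong (C v) (trans z≡y (sym x≡y))) ea))
      where z≡y = out-in-same-endpoint sd e z≢v sb eb y≢v d≢b
    fromIn : InColor C v d → d ∈ a ∷ b ∷ []
    fromIn (z , z≢v , e) with d ≟ a
    ... | yes d≡a = here d≡a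
    ... | no  d≢a = there (here (trans (sym e) (trans (cong (λ w → C w v) (trans (sym x≡z) x≡y)) eb)))
      where x≡z = out-in-same-endpoint sa ea x≢v sd e z≢v (≢-sym d≢a)

  mixed⇒satDegreeBelow≤2 : ∀ B {v a b} →
    SaturatedColor C v a → OutColor C v a → SaturatedColor C v b → InColor C v b →
    satDegreeBelow B C v ≤ 2
  mixed⇒satDegreeBelow≤2 B {v} {a} {b} sa oa sb ib with a ≟ b
  ... | no a≢b = satDegreeBelow-≤ B C v (saturated-within-pair sa oa sb ib a≢b)
  ... | yes refl with any? (λ d → ¬? (d ≟ a)) (saturatedColorsBelow B C v)
  ...   | no none = unique-⊆⇒length-≤ (saturatedColorsBelow-unique B C v) onlyA
    where
    onlyA : saturatedColorsBelow B C v ⊆ a ∷ a ∷ []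
    onlyA {d} d∈ with d ≟ a
    ... | yes d≡a = here d≡a
    ... | no  d≢a = ⊥-elim (none (lose d∈ d≢a))
  ...   | yes some with find some
  ...     | d , d∈ , d≢a =
    [ (λ od → satDegreeBelow-≤ B C v (saturated-within-pair sd od sb ib d≢a))
    , (λ id → satDegreeBelow-≤ B C v (saturated-within-pair sa oa sd id (≢-sym d≢a)))
    ] (saturated⇒incident C sd)
    where sd = ∈-saturatedColorsBelow⁻ B C v d∈

  saturation-trichotomy : ∀ B v → SaturatesOnlyOut C v ⊎ SaturatesOnlyIn C v ⊎ satDegreeBelow B C v ≤ 2
  saturation-trichotomy B v with FinP.any? (λ z → ¬? (z FinP.≟ v) ×-dec saturatedColor? C v (C z v))
  ... | no noIn = inj₁ (λ sc (z , z≢v , e) → noIn (z , z≢v , subst (SaturatedColor C v) (sym e) sc))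
  ... | yes (y , y≢v , sb) with FinP.any? (outSaturating? C v)
  ...   | no noOut =
    inj₂ (inj₁ (λ sc (z , z≢v , e) → noOut (z , z≢v , subst (SaturatedColor C v) (sym e) sc)))
  ...   | yes (x , x≢v , sa) =
    inj₂ (inj₂ (mixed⇒satDegreeBelow≤2 B sa (x , x≢v , refl) sb (y , y≢v , refl)))

  onlyOut-successor-onlyOut : ∀ {v x} → SaturatesOnlyOut C v → SaturatedColor C v (C v x) → x ≢ v →
    SaturatesOnlyOut C x → ∀ {d} → SaturatedColor C x d → d ≡ C x v
  onlyOut-successor-onlyOut {v} {x} onlyOutV sa x≢v onlyOutX {d} sd
    with saturatesOnlyOut⇒out C onlyOutX sd
  ... | z , z≢x , e with z FinP.≟ v
  ...   | yes refl = sym e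
  ...   | no  z≢v  = ⊥-elim (noRainbow (v , x , z , ≢-sym x≢v , ≢-sym z≢x , ≢-sym z≢v ,
          (λ eq → onlyOutX (subst (SaturatedColor C x) (sym (trans eq e)) sd) (v , ≢-sym x≢v , refl)) ,
          (λ eq → saturates-avoids C (proj₂ sd) z≢x (≢-sym x≢v) z≢v (trans (sym eq) e)) ,
          (λ eq → onlyOutV (subst (SaturatedColor C v) eq sa) (z , z≢v , refl))))

  satDegreeBelow-≤-notOutSaturating : ∀ B {v x} →
    SaturatesOnlyOut C v → x ≢ v → SaturatesOnlyIn C x →
    satDegreeBelow B C x ≤ length (filter (∁? (outSaturating? C v)) (allFin n))
  satDegreeBelow-≤-notOutSaturating B {v} {x} onlyOutV x≢v onlyInX =
    subst (satDegreeBelow B C x ≤_) (length-map (λ z → C z x) tails) (satDegreeBelow-≤ B C x sat⇒∈)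
    where
    tails = filter (∁? (outSaturating? C v)) (allFin n)
    sat⇒∈ : ∀ {c} → SaturatedColor C x c → c ∈ map (λ z → C z x) tails
    sat⇒∈ sc with saturatesOnlyIn⇒in C onlyInX sc
    ... | z , z≢x , refl =
      ∈-map⁺ (λ z → C z x) (∈-filter⁺ (∁? (outSaturating? C v)) (∈-allFin z) notOut)
      where
      notOut : ¬ OutSaturating C v z
      notOut (z≢v , sz) = noRainbow (v , z , x , ≢-sym z≢v , z≢x , ≢-sym x≢v ,
        (λ eq → saturates-avoids C (proj₂ sc) (≢-sym x≢v) z≢x (≢-sym z≢v) eq) ,
        (λ eq → onlyInX (subst (SaturatedColor C x) eq sc) (v , ≢-sym x≢v , refl)) ,
        (λ eq → onlyOutV (subst (SaturatedColor C v) eq sz) (x , x≢v , refl)))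

  onlyOut-successor-onlyIn : ∀ B {v x} → SaturatesOnlyOut C v → x ≢ v → SaturatesOnlyIn C x →
    satDegreeBelow B C v + satDegreeBelow B C x ≤ n
  onlyOut-successor-onlyIn B {v} onlyOutV x≢v onlyInX = begin
    satDegreeBelow B C v + satDegreeBelow B C _
      ≤⟨ +-mono-≤ (satDegreeBelow-≤-outSaturating C B onlyOutV)
                  (satDegreeBelow-≤-notOutSaturating B onlyOutV x≢v onlyInX) ⟩
    length (filter P? (allFin n)) + length (filter (∁? P?) (allFin n))
      ≡⟨ length-filter-+-length-filter-∁ P? (allFin n) ⟩
    length (allFin n)
      ≡⟨ length-tabulate (λ z → z) ⟩
    n ∎
    where
    open ≤-Reasoning
    P? = outSaturating? C v

  saturated-arc⇒small-vertex : ∀ B {v x} → 2 ≤ n / 2 → SaturatesOnlyOut C v →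
    SaturatedColor C v (C v x) → x ≢ v → ∃ λ w → satDegreeBelow B C w ≤ n / 2
  saturated-arc⇒small-vertex B {v} {x} 2≤n/2 onlyOutV sa x≢v with saturation-trichotomy B x
  ... | inj₂ (inj₂ ≤2) = x , ≤-trans ≤2 2≤n/2
  ... | inj₁ onlyOutX  = x , ≤-trans ≤1 (≤-trans (s≤s z≤n) 2≤n/2)
    where
    ≤1 : satDegreeBelow B C x ≤ 1
    ≤1 = satDegreeBelow-≤ B C x {C x v ∷ []}
           (λ sd → here (onlyOut-successor-onlyOut onlyOutV sa x≢v onlyOutX sd))
  ... | inj₂ (inj₁ onlyInX) with sum-≤⇒half (onlyOut-successor-onlyIn B onlyOutV x≢v onlyInX)
  ...   | inj₁ v-small = v , v-small
  ...   | inj₂ x-small = x , x-small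

  onlyOut⇒small-vertex : ∀ B {v} → 2 ≤ n / 2 → SaturatesOnlyOut C v →
    ∃ λ w → satDegreeBelow B C w ≤ n / 2
  onlyOut⇒small-vertex B {v} 2≤n/2 onlyOutV with saturatedColorsBelow B C v in eq
  ... | [] = v , subst (_≤ n / 2) (sym (cong (length {A = ℕ}) eq)) z≤n
  ... | a ∷ rest = fromArc (saturatesOnlyOut⇒out C onlyOutV sa)
    where
    sa : SaturatedColor C v a
    sa = ∈-saturatedColorsBelow⁻ B C v (subst (a ∈_) (sym eq) (here refl))
    fromArc : OutColor C v a → ∃ λ w → satDegreeBelow B C w ≤ n / 2
    fromArc (x , x≢v , e) =
      saturated-arc⇒small-vertex B 2≤n/2 onlyOutV (subst (SaturatedColor C v) (sym e) sa) x≢v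

converse : ∀ {n} → ArcColoring n → ArcColoring n
converse C x y = C y x

saturatedColor-converse : ∀ {n} (C : ArcColoring n) {v c} →
  SaturatedColor (converse C) v c → SaturatedColor C v c
saturatedColor-converse C (used , sat) with colorUsed⁻ (converse C) used
... | x , y , x≢y , e =
  colorUsed⁺ C y x (≢-sym x≢y) e ,
  saturates⁺ C (λ x y x≢y e → [ inj₂ , inj₁ ] (saturates⁻ (converse C) sat y x (≢-sym x≢y) e))

module _ {n : ℕ} (C : ArcColoring n) where

  satDegreeBelow-converse : ∀ B v → satDegreeBelow B (converse C) v ≡ satDegreeBelow B C v
  satDegreeBelow-converse B v = cong length (filter-≐ (saturatedColor? (converse C) v) (saturatedColor? C v)
    (saturatedColor-converse C , saturatedColor-converse (converse C)) (upTo B))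

  converse-rainbow : RainbowTriangle (converse C) → RainbowTriangle C
  converse-rainbow (x , y , z , x≢y , y≢z , x≢z , d₁ , d₂ , d₃) =
    x , z , y , x≢z , ≢-sym y≢z , x≢y , ≢-sym d₂ , ≢-sym d₁ , ≢-sym d₃

  onlyIn⇒converse-onlyOut : ∀ {v} → SaturatesOnlyIn C v → SaturatesOnlyOut (converse C) v
  onlyIn⇒converse-onlyOut onlyIn sc = onlyIn (saturatedColor-converse C sc)

small-vertex : ∀ {n} {C : ArcColoring n} → ¬ RainbowTriangle C → 2 ≤ n / 2 → Fin n →
  ∀ B → ∃ λ w → satDegreeBelow B C w ≤ n / 2
small-vertex {n} {C} noRainbow 2≤n/2 v B with saturation-trichotomy noRainbow B v
... | inj₂ (inj₂ ≤2)    = v , ≤-trans ≤2 2≤n/2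
... | inj₁ onlyOut      = onlyOut⇒small-vertex noRainbow B 2≤n/2 onlyOut
... | inj₂ (inj₁ onlyIn)
  with onlyOut⇒small-vertex (λ r → noRainbow (converse-rainbow C r)) B 2≤n/2
         (onlyIn⇒converse-onlyOut C onlyIn)
...   | w , le = w , subst (_≤ n / 2) (satDegreeBelow-converse C B w) le

lemma2 : (n : ℕ) → 4 ≤ n → (C : ArcColoring n) → ¬ RainbowTriangle C →
    Σ (Fin n) (λ v → satDegree C v ≤ n / 2)
lemma2 n 4≤n C noRainbow =
  small-vertex noRainbow (/-monoˡ-≤ 2 4≤n) (fromℕ< (≤-trans (s≤s z≤n) 4≤n)) (suc (maxColor C))
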